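{- Let $C$ be a bilinear circuit over $GF(2)$ that computes the product $x\cdot y$ of two $n\times n$ matrices $x,y$, and let $\mu_1(x)\eta_1(y),\dots,\mu_m(x)\eta_m(y)$ be the bilinear forms computed at its $m$ product gates ($\mu_i$ linear forms in the entries of $x$, $\eta_i$ linear forms in the entries of $y$). Define $\Gamma:M_n(GF(2))\to GF(2)^m$ by $\Gamma(x)=(\mu_1(x),\dots,\mu_m(x))$. Then $\Gamma$ is linear and $\mathrm{weight}(\Gamma(x))\ge n\cdot\mathrm{rank}(x)$ for every $x\in M_n(GF(2))$.
   Context: A bilinear circuit is an arithmetic circuit (directed acyclic graph of sum and product gates with field constants on edges, computing polynomials in the inputs) in which every product gate multiplies a linear form in the variables of $x$ by a linear form in the variables of $y$; its outputs are the $n^2$ entries $(x\cdot y)_{i,j}=\sum_k x_{i,k}y_{k,j}$. $\mathrm{weight}(v)$ is the number of nonzero coordinates of $v$. -}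

module Defs where

open import Data.Nat using (ℕ; zero; suc)
open import Data.Bool using (Bool; true; false; _∧_; _xor_)
open import Data.Fin using (Fin; zero; suc; _≟_)
open import Data.Vec using (Vec; []; _∷ʳ_; lookup)
open import Data.List using (List; []; _∷_; _++_; [_]; map; foldr)
open import Data.Product using (_×_; Σ; _,_)
open import Data.Unit using (⊤)
open import Relation.Nullary using (¬_)
open import Relation.Nullary.Decidable using (⌊_⌋)
open import Relation.Binary.PropositionalEquality using (_≡_)

-- GF(2) is modelled by Bool: addition = _xor_, multiplication = _∧_.

-- n × n matrices over GF(2); also used for coefficient vectors of
-- linear forms in the n² entries of x (resp. y).
Mat : ℕ → Set
Mat n = Fin n → Fin n → Bool

⊕Σ : ∀ {k} → (Fin k → Bool) → Bool
⊕Σ {zero}  f = false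
⊕Σ {suc k} f = f zero xor ⊕Σ (λ t → f (suc t))

applyLin : ∀ {n} → Mat n → Mat n → Bool
applyLin μ x = ⊕Σ (λ a → ⊕Σ (λ b → μ a b ∧ x a b))

_⊞_ : ∀ {n} → Mat n → Mat n → Mat n
(x ⊞ y) a b = x a b xor y a b

_·ₘ_ : ∀ {n} → Bool → Mat n → Mat n
(c ·ₘ x) a b = c ∧ x a b

-- Polynomials that can occur at gates of a bilinear circuit: (no constant
-- inputs) a linear form in x, a linear form in y, and a bilinear part.
-- bl a b c d is the coefficient of the monomial x_{a,b} y_{c,d}.
-- (Coefficientwise equality of this representation is polynomial equality.)
record Poly (n : ℕ) : Set where
  field
    lx : Mat n
    ly : Mat n
    bl : Fin n → Fin n → Fin n → Fin n → Bool
open Poly public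

δ : ∀ {n} → Fin n → Fin n → Mat n
δ i j a b = ⌊ a ≟ i ⌋ ∧ ⌊ b ≟ j ⌋

zeroPoly : ∀ {n} → Poly n
zeroPoly = record { lx = λ _ _ → false ; ly = λ _ _ → false ; bl = λ _ _ _ _ → false }

addPoly : ∀ {n} → Poly n → Poly n → Poly n
addPoly p q = record
  { lx = λ a b → lx p a b xor lx q a b
  ; ly = λ a b → ly p a b xor ly q a b
  ; bl = λ a b c d → bl p a b c d xor bl q a b c d }

scalePoly : ∀ {n} → Bool → Poly n → Poly n
scalePoly c p = record
  { lx = λ a b → c ∧ lx p a b
  ; ly = λ a b → c ∧ ly p a b
  ; bl = λ a b c' d → c ∧ bl p a b c' d }

mulPoly : ∀ {n} → Poly n → Poly n → Poly n
mulPoly p q = record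
  { lx = λ _ _ → false ; ly = λ _ _ → false
  ; bl = λ a b c d → lx p a b ∧ ly q c d }

-- A gate whose inputs may only be among the k previously built gates.
data Gate (n k : ℕ) : Set where
  inX  : Fin n → Fin n → Gate n k
  inY  : Fin n → Fin n → Gate n k
  sum  : List (Bool × Fin k) → Gate n k        -- sum gate; field constants on edges
  prod : Fin k → Fin k → Gate n k              -- product gate (x-side input, y-side input)

-- A circuit (DAG) listed in topological order.
data Circuit (n : ℕ) : ℕ → Set where
  []  : Circuit n zero
  _▷_ : ∀ {k} → Circuit n k → Gate n k → Circuit n (suc k)

gateVal : ∀ {n k} → Vec (Poly n) k → Gate n k → Poly n
gateVal vs (inX a b) = record { lx = δ a b ; ly = λ _ _ → false ; bl = λ _ _ _ _ → false }
gateVal vs (inY a b) = record { lx = λ _ _ → false ; ly = δ a b ; bl = λ _ _ _ _ → false }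
gateVal vs (sum es)  = foldr (λ { (c , u) acc → addPoly (scalePoly c (lookup vs u)) acc }) zeroPoly es
gateVal vs (prod u v) = mulPoly (lookup vs u) (lookup vs v)

values : ∀ {n k} → Circuit n k → Vec (Poly n) k
values []      = []
values (C ▷ g) = values C ∷ʳ gateVal (values C) g

XLinear : ∀ {n} → Poly n → Set
XLinear p = (∀ a b → ly p a b ≡ false) × (∀ a b c d → bl p a b c d ≡ false)

YLinear : ∀ {n} → Poly n → Set
YLinear p = (∀ a b → lx p a b ≡ false) × (∀ a b c d → bl p a b c d ≡ false)

GateOK : ∀ {n k} → Vec (Poly n) k → Gate n k → Set
GateOK vs (prod u v) = XLinear (lookup vs u) × YLinear (lookup vs v)
GateOK vs _          = ⊤

IsBilinear : ∀ {n k} → Circuit n k → Set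
IsBilinear []      = ⊤
IsBilinear (C ▷ g) = IsBilinear C × GateOK (values C) g

-- p equals the polynomial (x·y)_{i,j} = Σ_l x_{i,l} y_{l,j}.
ComputesEntry : ∀ {n} → Poly n → Fin n → Fin n → Set
ComputesEntry p i j =
  (∀ a b → lx p a b ≡ false) × (∀ a b → ly p a b ≡ false) ×
  (∀ a b c d → bl p a b c d ≡ (⌊ a ≟ i ⌋ ∧ (⌊ b ≟ c ⌋ ∧ ⌊ d ≟ j ⌋)))

record MatMulCircuit (n : ℕ) : Set where
  field
    size     : ℕ
    circuit  : Circuit n size
    bilinear : IsBilinear circuit
    output   : Fin n → Fin n → Fin size
    computes : ∀ i j → ComputesEntry (lookup (values circuit) (output i j)) i j
open MatMulCircuit public

muForms : ∀ {n k} → Circuit n k → List (Mat n)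
muForms []             = []
muForms (C ▷ prod u v) = muForms C ++ [ lx (lookup (values C) u) ]
muForms (C ▷ inX _ _)  = muForms C
muForms (C ▷ inY _ _)  = muForms C
muForms (C ▷ sum _)    = muForms C

Γ : ∀ {n} → MatMulCircuit n → Mat n → List Bool
Γ C x = map (λ μ → applyLin μ x) (muForms (circuit C))

weight : List Bool → ℕ
weight []          = zero
weight (true ∷ v)  = suc (weight v)
weight (false ∷ v) = weight v

RowsIndependent : ∀ {n r} → Mat n → (Fin r → Fin n) → Set
RowsIndependent {n} {r} x f =
  (c : Fin r → Bool) → (∀ b → ⊕Σ (λ t → c t ∧ x (f t) b) ≡ false) → ∀ t → c t ≡ false

HasIndependentRows : ∀ {n} → Mat n → ℕ → Set
HasIndependentRows {n} x r = Σ (Fin r → Fin n) (RowsIndependent x)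

IsRank : ∀ {n} → Mat n → ℕ → Set
IsRank x r = HasIndependentRows x r × ¬ HasIndependentRows x (suc r)

-- Fix x. Substituting x into the bilinear part of each gate's polynomial leaves a linear form in y.
-- A product gate carries μᵢ(x)·ηᵢ and sum gates take linear combinations, so every gate's form lies
-- in the span of the ηᵢ with μᵢ(x) = 1, and there are weight(Γ(x)) of those. Output (i, j) carries
-- y ↦ (x·y)ᵢⱼ, whose coefficient matrix has row i of x as its column j; for r independent rows of x
-- these n·r matrices are independent. Independent vectors in the span of m vectors number at most m,
-- which over GF(2) follows by counting: the coefficient map embeds GF(2)^(n·r) into GF(2)^m.

module Submission where

open import Defs
open import Data.Nat using (ℕ; _*_; _≤_)
open import Data.Bool using (Bool; _∧_; _xor_)
open import Data.List using (map; zipWith)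
open import Data.Product using (_×_)
open import Relation.Binary.PropositionalEquality using (_≡_)

open import Algebra.Bundles using (CommutativeRing; CommutativeMonoid)
open import Data.Bool using (true; false; if_then_else_)
open import Data.Bool.Properties
  using (∧-assoc; ∧-comm; ∧-identityʳ; ∧-zeroʳ; ∧-distribˡ-xor; ∧-distribʳ-xor;
         xor-assoc; xor-identityʳ; xor-same; ∧-commutativeMonoid; xor-∧-commutativeRing)
open import Data.Fin using (Fin; zero; suc; _≟_; _↑ˡ_; _↑ʳ_; combine; remQuot; funToFin; finToFun)
open import Data.Fin.Properties
  using (suc-injective; combine-remQuot; remQuot-combine; 2↔Bool;
         funToFin-finToFin; finToFun-funToFin; injective⇒≤)
open import Data.List using (List; []; _∷_; _++_; [_]; length; lookup)
open import Data.List.Properties using (map-++; map-cong; map-∘)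
open import Data.Nat using (zero; suc; _+_; _^_; z<s; s<s)
open import Data.Nat.Properties using (≮⇒≥; <⇒≱; ^-monoʳ-<)
open import Data.Product using (∃; _,_; proj₁; proj₂; uncurry)
open import Data.Vec using (Vec; []; _∷_; _∷ʳ_)
import Data.Vec as Vec
open import Data.Vec.Relation.Unary.All as All using (All; []; _∷_)
open import Data.Vec.Relation.Unary.All.Properties using (lookup⁺)
open import Function using (_∘_; flip; id)
open import Function.Bundles using (Inverse)
open import Relation.Nullary using (Dec; ¬_)
open import Relation.Nullary.Decidable using (⌊_⌋; isYes≗does; dec-true; dec-false)
open import Relation.Binary.PropositionalEquality
  using (_≢_; _≗_; refl; sym; trans; cong; cong₂; subst; ≢-sym; module ≡-Reasoning)

import Algebra.Properties.Semiring.Sum as SemiringSum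
import Algebra.Properties.CommutativeSemigroup as CommutativeSemigroupProperties

open SemiringSum (CommutativeRing.semiring xor-∧-commutativeRing)
  renaming (sum to ∑)
  using (sum-cong-≗; sum-replicate-zero; ∑-distrib-+; ∑-comm; *-distribˡ-sum; *-distribʳ-sum)
open CommutativeSemigroupProperties (CommutativeMonoid.commutativeSemigroup ∧-commutativeMonoid)
  renaming (x∙yz≈y∙xz to ∧-swapˡ)
  using ()

open ≡-Reasoning

isYes-true : ∀ {A : Set} (a? : Dec A) → A → ⌊ a? ⌋ ≡ true
isYes-true a? a = trans (isYes≗does a?) (dec-true a? a)

isYes-false : ∀ {A : Set} (a? : Dec A) → ¬ A → ⌊ a? ⌋ ≡ false
isYes-false a? ¬a = trans (isYes≗does a?) (dec-false a? ¬a)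

xor≡false⇒≡ : ∀ a b → a xor b ≡ false → a ≡ b
xor≡false⇒≡ false false _ = refl
xor≡false⇒≡ true  true  _ = refl

⊕Σ≡∑ : ∀ {k} (f : Fin k → Bool) → ⊕Σ f ≡ ∑ f
⊕Σ≡∑ {zero}  f = refl
⊕Σ≡∑ {suc k} f = cong (f zero xor_) (⊕Σ≡∑ (f ∘ suc))

⊕Σ-cong : ∀ {k} {f g : Fin k → Bool} → f ≗ g → ⊕Σ f ≡ ⊕Σ g
⊕Σ-cong {zero}  f≗g = refl
⊕Σ-cong {suc k} f≗g = cong₂ _xor_ (f≗g zero) (⊕Σ-cong (f≗g ∘ suc))

⊕Σ-zero : ∀ {k} {f : Fin k → Bool} → (∀ t → f t ≡ false) → ⊕Σ f ≡ false
⊕Σ-zero {k} f≗0 = trans (⊕Σ-cong f≗0) (trans (⊕Σ≡∑ {k} (λ _ → false)) (sum-replicate-zero k))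

⊕Σ-distrib-xor : ∀ {k} (f g : Fin k → Bool) → ⊕Σ (λ t → f t xor g t) ≡ ⊕Σ f xor ⊕Σ g
⊕Σ-distrib-xor f g = begin
  ⊕Σ (λ t → f t xor g t) ≡⟨ ⊕Σ≡∑ (λ t → f t xor g t) ⟩
  ∑ (λ t → f t xor g t)  ≡⟨ ∑-distrib-+ f g ⟩
  ∑ f xor ∑ g            ≡⟨ sym (cong₂ _xor_ (⊕Σ≡∑ f) (⊕Σ≡∑ g)) ⟩
  ⊕Σ f xor ⊕Σ g          ∎

∧-distribˡ-⊕Σ : ∀ {k} c (f : Fin k → Bool) → c ∧ ⊕Σ f ≡ ⊕Σ (λ t → c ∧ f t)
∧-distribˡ-⊕Σ c f = begin
  c ∧ ⊕Σ f           ≡⟨ cong (c ∧_) (⊕Σ≡∑ f) ⟩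
  c ∧ ∑ f            ≡⟨ *-distribˡ-sum c f ⟩
  ∑ (λ t → c ∧ f t)  ≡⟨ sym (⊕Σ≡∑ (λ t → c ∧ f t)) ⟩
  ⊕Σ (λ t → c ∧ f t) ∎

∧-distribʳ-⊕Σ : ∀ {k} c (f : Fin k → Bool) → ⊕Σ f ∧ c ≡ ⊕Σ (λ t → f t ∧ c)
∧-distribʳ-⊕Σ c f = begin
  ⊕Σ f ∧ c           ≡⟨ cong (_∧ c) (⊕Σ≡∑ f) ⟩
  ∑ f ∧ c            ≡⟨ *-distribʳ-sum c f ⟩
  ∑ (λ t → f t ∧ c)  ≡⟨ sym (⊕Σ≡∑ (λ t → f t ∧ c)) ⟩
  ⊕Σ (λ t → f t ∧ c) ∎

⊕Σ-comm : ∀ {k l} (f : Fin k → Fin l → Bool) →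
          ⊕Σ (λ s → ⊕Σ (λ t → f s t)) ≡ ⊕Σ (λ t → ⊕Σ (λ s → f s t))
⊕Σ-comm f = begin
  ⊕Σ (λ s → ⊕Σ (f s))         ≡⟨ ⊕Σ²≡∑² f ⟩
  ∑ (λ s → ∑ (f s))           ≡⟨ ∑-comm f ⟩
  ∑ (λ t → ∑ (λ s → f s t))   ≡⟨ sym (⊕Σ²≡∑² (flip f)) ⟩
  ⊕Σ (λ t → ⊕Σ (λ s → f s t)) ∎
  where
  ⊕Σ²≡∑² : ∀ {k l} (g : Fin k → Fin l → Bool) → ⊕Σ (λ s → ⊕Σ (g s)) ≡ ∑ (λ s → ∑ (g s))
  ⊕Σ²≡∑² g = trans (⊕Σ≡∑ (λ s → ⊕Σ (g s))) (sum-cong-≗ (λ s → ⊕Σ≡∑ (g s)))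

⊕Σ-↑ : ∀ {m n} (f : Fin (m + n) → Bool) →
       ⊕Σ f ≡ ⊕Σ (λ i → f (i ↑ˡ n)) xor ⊕Σ (λ j → f (m ↑ʳ j))
⊕Σ-↑ {zero}  f = refl
⊕Σ-↑ {suc m} {n} f =
  trans (cong (f zero xor_) (⊕Σ-↑ {m} {n} (f ∘ suc))) (sym (xor-assoc (f zero) _ _))

⊕Σ-combine : ∀ {m n} (f : Fin (m * n) → Bool) →
             ⊕Σ f ≡ ⊕Σ (λ (i : Fin m) → ⊕Σ (λ (j : Fin n) → f (combine i j)))
⊕Σ-combine {zero}      f = refl
⊕Σ-combine {suc m} {n} f =
  trans (⊕Σ-↑ {n} {m * n} f)
        (cong (⊕Σ (λ j → f (j ↑ˡ m * n)) xor_) (⊕Σ-combine {m} {n} (f ∘ (n ↑ʳ_))))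

⊕Σ-single : ∀ {k} {f : Fin k → Bool} i → (∀ t → t ≢ i → f t ≡ false) → ⊕Σ f ≡ f i
⊕Σ-single {suc k} {f} zero    off =
  trans (cong (f zero xor_) (⊕Σ-zero (λ t → off (suc t) λ ()))) (xor-identityʳ (f zero))
⊕Σ-single {suc k} {f} (suc i) off =
  trans (cong (_xor ⊕Σ (f ∘ suc)) (off zero λ ()))
        (⊕Σ-single i (λ t t≢i → off (suc t) (t≢i ∘ suc-injective)))

⊕Σ-δˡ : ∀ {k} (i : Fin k) (f : Fin k → Bool) → ⊕Σ (λ t → ⌊ t ≟ i ⌋ ∧ f t) ≡ f i
⊕Σ-δˡ i f = trans (⊕Σ-single i (λ t t≢i → cong (_∧ f t) (isYes-false (t ≟ i) t≢i)))
                  (cong (_∧ f i) (isYes-true (i ≟ i) refl))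

⊕Σ-δʳ : ∀ {k} (i : Fin k) (f : Fin k → Bool) → ⊕Σ (λ t → ⌊ i ≟ t ⌋ ∧ f t) ≡ f i
⊕Σ-δʳ i f = trans (⊕Σ-single i (λ t t≢i → cong (_∧ f t) (isYes-false (i ≟ t) (≢-sym t≢i))))
                  (cong (_∧ f i) (isYes-true (i ≟ i) refl))

⊕Σ² : ∀ {k l} → (Fin k → Fin l → Bool) → Bool
⊕Σ² f = ⊕Σ (λ a → ⊕Σ (f a))

⊕Σ²-cong : ∀ {k l} {f g : Fin k → Fin l → Bool} → (∀ a b → f a b ≡ g a b) → ⊕Σ² f ≡ ⊕Σ² g
⊕Σ²-cong f≗g = ⊕Σ-cong (λ a → ⊕Σ-cong (f≗g a))

⊕Σ²-distrib-xor : ∀ {k l} (f g : Fin k → Fin l → Bool) →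
                  ⊕Σ² (λ a b → f a b xor g a b) ≡ ⊕Σ² f xor ⊕Σ² g
⊕Σ²-distrib-xor f g =
  trans (⊕Σ-cong (λ a → ⊕Σ-distrib-xor (f a) (g a)))
        (⊕Σ-distrib-xor (λ a → ⊕Σ (f a)) (λ a → ⊕Σ (g a)))

∧-distribˡ-⊕Σ² : ∀ {k l} c (f : Fin k → Fin l → Bool) → c ∧ ⊕Σ² f ≡ ⊕Σ² (λ a b → c ∧ f a b)
∧-distribˡ-⊕Σ² c f =
  trans (∧-distribˡ-⊕Σ c (λ a → ⊕Σ (f a))) (⊕Σ-cong (λ a → ∧-distribˡ-⊕Σ c (f a)))

funToFin-cong : ∀ {m n} {f g : Fin m → Fin n} → f ≗ g → funToFin f ≡ funToFin g
funToFin-cong {zero}  f≗g = refl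
funToFin-cong {suc m} f≗g = cong₂ combine (f≗g zero) (funToFin-cong (f≗g ∘ suc))

module _ {N : ℕ} where
  open Inverse 2↔Bool using (to; from; strictlyInverseˡ; strictlyInverseʳ)

  toFin : (Fin N → Bool) → Fin (2 ^ N)
  toFin z = funToFin (from ∘ z)

  fromFin : Fin (2 ^ N) → Fin N → Bool
  fromFin i = to ∘ finToFun i

  fromFin-toFin : ∀ z → fromFin (toFin z) ≗ z
  fromFin-toFin z s = trans (cong to (finToFun-funToFin (from ∘ z) s)) (strictlyInverseˡ (z s))

  fromFin-injective : ∀ {i j} → fromFin i ≗ fromFin j → i ≡ j
  fromFin-injective {i} {j} eq = begin
    i                              ≡⟨ sym (funToFin-finToFin {N} i) ⟩
    funToFin (finToFun {2} {N} i)  ≡⟨ funToFin-cong (λ s → to-injective (eq s)) ⟩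
    funToFin (finToFun {2} {N} j)  ≡⟨ funToFin-finToFin {N} j ⟩
    j                              ∎
    where
    to-injective : ∀ {a b} → to a ≡ to b → a ≡ b
    to-injective {a} {b} eq =
      trans (sym (strictlyInverseʳ a)) (trans (cong from eq) (strictlyInverseʳ b))

Bool^-injection⇒≤ : ∀ {N w} (D : (Fin N → Bool) → Fin w → Bool) →
                    (∀ {z z'} → D z ≗ D z' → z ≗ z') → N ≤ w
Bool^-injection⇒≤ {N} {w} D D-injective =
  ≮⇒≥ (λ w<N → <⇒≱ (^-monoʳ-< 2 (s<s z<s) w<N) 2^N≤2^w)
  where
  encoded : Fin (2 ^ N) → Fin (2 ^ w)
  encoded = toFin ∘ D ∘ fromFin

  2^N≤2^w : 2 ^ N ≤ 2 ^ w
  2^N≤2^w = injective⇒≤ {f = encoded} λ {i} {j} eq → fromFin-injective (D-injective λ k → begin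
    D (fromFin i) k        ≡⟨ sym (fromFin-toFin (D (fromFin i)) k) ⟩
    fromFin (encoded i) k  ≡⟨ cong (λ e → fromFin e k) eq ⟩
    fromFin (encoded j) k  ≡⟨ fromFin-toFin (D (fromFin j)) k ⟩
    D (fromFin j) k        ∎)

private
  variable
    I : Set
    m N : ℕ

lincomb : (Fin m → Bool) → (Fin m → I → Bool) → I → Bool
lincomb c v i = ⊕Σ (λ k → c k ∧ v k i)

LinearlyIndependent : (Fin m → I → Bool) → Set
LinearlyIndependent v = ∀ c → (∀ i → lincomb c v i ≡ false) → ∀ k → c k ≡ false

_∈Span_ : (I → Bool) → (Fin m → I → Bool) → Set
w ∈Span v = ∃ λ c → w ≗ lincomb c v

lincomb-congˡ : ∀ {c c' : Fin m → Bool} (v : Fin m → I → Bool) → c ≗ c' → lincomb c v ≗ lincomb c' v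
lincomb-congˡ v c≗c' i = ⊕Σ-cong (λ k → cong (_∧ v k i) (c≗c' k))

lincomb-xor : ∀ (c c' : Fin m → Bool) (v : Fin m → I → Bool) i →
              lincomb (λ k → c k xor c' k) v i ≡ lincomb c v i xor lincomb c' v i
lincomb-xor c c' v i =
  trans (⊕Σ-cong (λ k → ∧-distribʳ-xor (v k i) (c k) (c' k)))
        (⊕Σ-distrib-xor (λ k → c k ∧ v k i) (λ k → c' k ∧ v k i))

lincomb-∧ : ∀ b (c : Fin m → Bool) (v : Fin m → I → Bool) i →
            lincomb (λ k → b ∧ c k) v i ≡ b ∧ lincomb c v i
lincomb-∧ b c v i =
  trans (⊕Σ-cong (λ k → ∧-assoc b (c k) (v k i))) (sym (∧-distribˡ-⊕Σ b (λ k → c k ∧ v k i)))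

lincomb-lincomb : ∀ (z : Fin N → Bool) (a : Fin N → Fin m → Bool) {u : Fin N → I → Bool}
                  (v : Fin m → I → Bool) → (∀ s → u s ≗ lincomb (a s) v) →
                  lincomb z u ≗ lincomb (lincomb z a) v
lincomb-lincomb z a {u} v u≗av i = begin
  ⊕Σ (λ s → z s ∧ u s i)
    ≡⟨ ⊕Σ-cong (λ s → cong (z s ∧_) (u≗av s i)) ⟩
  ⊕Σ (λ s → z s ∧ ⊕Σ (λ k → a s k ∧ v k i))
    ≡⟨ ⊕Σ-cong (λ s → ∧-distribˡ-⊕Σ (z s) (λ k → a s k ∧ v k i)) ⟩
  ⊕Σ (λ s → ⊕Σ (λ k → z s ∧ (a s k ∧ v k i)))
    ≡⟨ ⊕Σ-comm (λ s k → z s ∧ (a s k ∧ v k i)) ⟩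
  ⊕Σ (λ k → ⊕Σ (λ s → z s ∧ (a s k ∧ v k i)))
    ≡⟨ ⊕Σ-cong (λ k → ⊕Σ-cong (λ s → sym (∧-assoc (z s) (a s k) (v k i)))) ⟩
  ⊕Σ (λ k → ⊕Σ (λ s → (z s ∧ a s k) ∧ v k i))
    ≡⟨ ⊕Σ-cong (λ k → sym (∧-distribʳ-⊕Σ (v k i) (λ s → z s ∧ a s k))) ⟩
  ⊕Σ (λ k → ⊕Σ (λ s → z s ∧ a s k) ∧ v k i)
    ∎

∈Span-resp-≗ : ∀ {w w' : I → Bool} {v : Fin m → I → Bool} → w ≗ w' → w' ∈Span v → w ∈Span v
∈Span-resp-≗ w≗w' (c , w'≗cv) = c , λ i → trans (w≗w' i) (w'≗cv i)

∈Span-zero : ∀ {v : Fin m → I → Bool} → (λ _ → false) ∈Span v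
∈Span-zero {m} = (λ _ → false) , λ _ → sym (⊕Σ-zero {m} (λ _ → refl))

∈Span-xor : ∀ {w w' : I → Bool} {v : Fin m → I → Bool} →
            w ∈Span v → w' ∈Span v → (λ i → w i xor w' i) ∈Span v
∈Span-xor {v = v} (c , w≗cv) (c' , w'≗c'v) =
  (λ k → c k xor c' k) , λ i → trans (cong₂ _xor_ (w≗cv i) (w'≗c'v i)) (sym (lincomb-xor c c' v i))

∈Span-∧ : ∀ b {w : I → Bool} {v : Fin m → I → Bool} → w ∈Span v → (λ i → b ∧ w i) ∈Span v
∈Span-∧ b {v = v} (c , w≗cv) =
  (λ k → b ∧ c k) , λ i → trans (cong (b ∧_) (w≗cv i)) (sym (lincomb-∧ b c v i))

independent-∈Span⇒≤ : ∀ {N m} {u : Fin N → I → Bool} {v : Fin m → I → Bool} →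
                      LinearlyIndependent u → (∀ s → u s ∈Span v) → N ≤ m
independent-∈Span⇒≤ {N = N} {m} {u} {v} u-independent u∈v =
  Bool^-injection⇒≤ (λ z → lincomb z a) injective
  where
  a : Fin N → Fin m → Bool
  a s = proj₁ (u∈v s)

  u≗av : ∀ s → u s ≗ lincomb (a s) v
  u≗av s = proj₂ (u∈v s)

  injective : ∀ {z z'} → lincomb z a ≗ lincomb z' a → z ≗ z'
  injective {z} {z'} za≗z'a s =
    xor≡false⇒≡ (z s) (z' s) (u-independent (λ s → z s xor z' s) difference-vanishes s)
    where
    difference-vanishes : ∀ i → lincomb (λ s → z s xor z' s) u i ≡ false
    difference-vanishes i = begin
      lincomb (λ s → z s xor z' s) u i
        ≡⟨ lincomb-xor z z' u i ⟩
      lincomb z u i xor lincomb z' u i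
        ≡⟨ cong₂ _xor_ (lincomb-lincomb z a v u≗av i) (lincomb-lincomb z' a v u≗av i) ⟩
      lincomb (lincomb z a) v i xor lincomb (lincomb z' a) v i
        ≡⟨ cong (_xor lincomb (lincomb z' a) v i) (lincomb-congˡ v za≗z'a i) ⟩
      lincomb (lincomb z' a) v i xor lincomb (lincomb z' a) v i
        ≡⟨ xor-same (lincomb (lincomb z' a) v i) ⟩
      false
        ∎

consIf : ∀ {A : Set} → Bool → A → List A → List A
consIf b e es = if b then e ∷ es else es

∈Span-consIf : ∀ b e (es : List (I → Bool)) {w} → w ∈Span lookup es → w ∈Span lookup (consIf b e es)
∈Span-consIf false e es w∈es        = w∈es
∈Span-consIf true  e es (c , w≗ces) = (λ { zero → false ; (suc k) → c k }) , w≗ces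

head-∈Span-consIf : ∀ b (e : I → Bool) es → (λ i → e i ∧ b) ∈Span lookup (consIf b e es)
head-∈Span-consIf false e es = ∈Span-resp-≗ (λ i → ∧-zeroʳ (e i)) ∈Span-zero
head-∈Span-consIf true  e es = (λ { zero → true ; (suc _) → false }) , λ i → begin
  e i ∧ true                           ≡⟨ ∧-identityʳ (e i) ⟩
  e i                                  ≡⟨ sym (xor-identityʳ (e i)) ⟩
  e i xor false                        ≡⟨ cong (e i xor_) (sym (⊕Σ-zero {length es} (λ _ → refl))) ⟩
  e i xor ⊕Σ {length es} (λ _ → false) ∎

module _ {n : ℕ} where

  applyLin-cong : ∀ {μ μ' : Mat n} → (∀ a b → μ a b ≡ μ' a b) → ∀ x → applyLin μ x ≡ applyLin μ' x
  applyLin-cong μ≗μ' x = ⊕Σ²-cong (λ a b → cong (_∧ x a b) (μ≗μ' a b))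

  applyLin-zeroˡ : ∀ (x : Mat n) → applyLin (λ _ _ → false) x ≡ false
  applyLin-zeroˡ x = ⊕Σ-zero {n} (λ a → ⊕Σ-zero {n} (λ b → refl))

  applyLin-⊞ˡ : ∀ (μ μ' x : Mat n) → applyLin (μ ⊞ μ') x ≡ applyLin μ x xor applyLin μ' x
  applyLin-⊞ˡ μ μ' x =
    trans (⊕Σ²-cong (λ a b → ∧-distribʳ-xor (x a b) (μ a b) (μ' a b)))
          (⊕Σ²-distrib-xor (λ a b → μ a b ∧ x a b) (λ a b → μ' a b ∧ x a b))

  applyLin-⊞ʳ : ∀ (μ x x' : Mat n) → applyLin μ (x ⊞ x') ≡ applyLin μ x xor applyLin μ x'
  applyLin-⊞ʳ μ x x' =
    trans (⊕Σ²-cong (λ a b → ∧-distribˡ-xor (μ a b) (x a b) (x' a b)))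
          (⊕Σ²-distrib-xor (λ a b → μ a b ∧ x a b) (λ a b → μ a b ∧ x' a b))

  applyLin-·ˡ : ∀ c (μ x : Mat n) → applyLin (c ·ₘ μ) x ≡ c ∧ applyLin μ x
  applyLin-·ˡ c μ x =
    trans (⊕Σ²-cong (λ a b → ∧-assoc c (μ a b) (x a b)))
          (sym (∧-distribˡ-⊕Σ² c (λ a b → μ a b ∧ x a b)))

  applyLin-·ʳ : ∀ c (μ x : Mat n) → applyLin μ (c ·ₘ x) ≡ c ∧ applyLin μ x
  applyLin-·ʳ c μ x =
    trans (⊕Σ²-cong (λ a b → ∧-swapˡ (μ a b) c (x a b)))
          (sym (∧-distribˡ-⊕Σ² c (λ a b → μ a b ∧ x a b)))

  applyLin-δ : ∀ i j (x : Mat n) → applyLin (δ i j) x ≡ x i j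
  applyLin-δ i j x = begin
    ⊕Σ (λ a → ⊕Σ (λ b → (⌊ a ≟ i ⌋ ∧ ⌊ b ≟ j ⌋) ∧ x a b))
      ≡⟨ ⊕Σ-cong (λ a → trans (⊕Σ-cong (λ b → ∧-assoc ⌊ a ≟ i ⌋ ⌊ b ≟ j ⌋ (x a b)))
                              (sym (∧-distribˡ-⊕Σ ⌊ a ≟ i ⌋ (λ b → ⌊ b ≟ j ⌋ ∧ x a b)))) ⟩
    ⊕Σ (λ a → ⌊ a ≟ i ⌋ ∧ ⊕Σ (λ b → ⌊ b ≟ j ⌋ ∧ x a b))
      ≡⟨ ⊕Σ-δˡ i (λ a → ⊕Σ (λ b → ⌊ b ≟ j ⌋ ∧ x a b)) ⟩
    ⊕Σ (λ b → ⌊ b ≟ j ⌋ ∧ x i b)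
      ≡⟨ ⊕Σ-δˡ j (x i) ⟩
    x i j
      ∎

inColumn : ∀ {n} → (Fin n → Bool) → Fin n → Fin n × Fin n → Bool
inColumn v j (c , d) = ⌊ d ≟ j ⌋ ∧ v c

inColumns : ∀ {n r} → (Fin r → Fin n → Bool) → Fin (n * r) → Fin n × Fin n → Bool
inColumns {n} {r} v s = inColumn (v (proj₂ (remQuot {n} r s))) (proj₁ (remQuot {n} r s))

inColumns-combine : ∀ {n r} (v : Fin r → Fin n → Bool) j t →
                    inColumns v (combine j t) ≡ inColumn (v t) j
inColumns-combine v j t = cong (λ jt → inColumn (v (proj₂ jt)) (proj₁ jt)) (remQuot-combine j t)

inColumns-independent : ∀ {n r} {v : Fin r → Fin n → Bool} →
                        LinearlyIndependent v → LinearlyIndependent (inColumns v)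
inColumns-independent {n} {r} {v} v-independent z z-vanishes s = begin
  z s      ≡⟨ cong z (sym (combine-remQuot {n} r s)) ⟩
  z′ j t   ≡⟨ v-independent (z′ j) (column-vanishes j) t ⟩
  false    ∎
  where
  j = proj₁ (remQuot {n} r s)
  t = proj₂ (remQuot {n} r s)

  z′ : Fin n → Fin r → Bool
  z′ j t = z (combine j t)

  column-vanishes : ∀ j c → ⊕Σ (λ t → z′ j t ∧ v t c) ≡ false
  column-vanishes j c = begin
    ⊕Σ (λ t → z′ j t ∧ v t c)
      ≡⟨ sym (⊕Σ-δʳ j (λ j' → ⊕Σ (λ t → z′ j' t ∧ v t c))) ⟩
    ⊕Σ (λ j' → ⌊ j ≟ j' ⌋ ∧ ⊕Σ (λ t → z′ j' t ∧ v t c))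
      ≡⟨ ⊕Σ-cong (λ j' → trans (∧-distribˡ-⊕Σ ⌊ j ≟ j' ⌋ (λ t → z′ j' t ∧ v t c))
                               (⊕Σ-cong (λ t → ∧-swapˡ ⌊ j ≟ j' ⌋ (z′ j' t) (v t c)))) ⟩
    ⊕Σ (λ j' → ⊕Σ (λ t → z′ j' t ∧ inColumn (v t) j' (c , j)))
      ≡⟨ ⊕Σ-cong (λ j' → ⊕Σ-cong (λ t →
           cong (λ w → z′ j' t ∧ w (c , j)) (sym (inColumns-combine v j' t)))) ⟩
    ⊕Σ (λ j' → ⊕Σ (λ t → z′ j' t ∧ inColumns v (combine j' t) (c , j)))
      ≡⟨ sym (⊕Σ-combine {n} {r} (λ s → z s ∧ inColumns v s (c , j))) ⟩
    lincomb z (inColumns v) (c , j)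
      ≡⟨ z-vanishes (c , j) ⟩
    false
      ∎

length-consIf : ∀ {A : Set} b (e : A) es bs →
                length es ≡ weight bs → length (consIf b e es) ≡ weight (b ∷ bs)
length-consIf true  e es bs eq = cong suc eq
length-consIf false e es bs eq = eq

weight-∷ʳ : ∀ bs b → weight (bs ++ [ b ]) ≡ weight (b ∷ bs)
weight-∷ʳ []          b     = refl
weight-∷ʳ (true ∷ bs)  true  = cong suc (weight-∷ʳ bs true)
weight-∷ʳ (true ∷ bs)  false = cong suc (weight-∷ʳ bs false)
weight-∷ʳ (false ∷ bs) true  = weight-∷ʳ bs true
weight-∷ʳ (false ∷ bs) false = weight-∷ʳ bs false

∷ʳ⁺ : ∀ {A : Set} {P : A → Set} {k} {xs : Vec A k} {y} → All P xs → P y → All P (xs ∷ʳ y)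
∷ʳ⁺ []         py = py ∷ []
∷ʳ⁺ (px ∷ pxs) py = px ∷ ∷ʳ⁺ pxs py

xFactor : ∀ {n k} → Circuit n k → Fin k → Mat n
xFactor C u = lx (Vec.lookup (values C) u)

yFactor : ∀ {n k} → Circuit n k → Fin k → Fin n × Fin n → Bool
yFactor C v = uncurry (ly (Vec.lookup (values C) v))

module _ {n : ℕ} (x : Mat n) where

  yForm : Poly n → Fin n × Fin n → Bool
  yForm p (c , d) = applyLin (λ a b → bl p a b c d) x

  activeForms : ∀ {k} → Circuit n k → List (Fin n × Fin n → Bool)
  activeForms []             = []
  activeForms (C ▷ inX _ _)  = activeForms C
  activeForms (C ▷ inY _ _)  = activeForms C
  activeForms (C ▷ sum _)    = activeForms C
  activeForms (C ▷ prod u v) = consIf (applyLin (xFactor C u) x) (yFactor C v) (activeForms C)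

  yForm-addPoly : ∀ p q → yForm (addPoly p q) ≗ λ i → yForm p i xor yForm q i
  yForm-addPoly p q (c , d) = applyLin-⊞ˡ (λ a b → bl p a b c d) (λ a b → bl q a b c d) x

  yForm-scalePoly : ∀ s p → yForm (scalePoly s p) ≗ λ i → s ∧ yForm p i
  yForm-scalePoly s p (c , d) = applyLin-·ˡ s (λ a b → bl p a b c d) x

  yForm-mulPoly : ∀ p q → yForm (mulPoly p q) ≗ λ i → uncurry (ly q) i ∧ applyLin (lx p) x
  yForm-mulPoly p q (c , d) =
    trans (applyLin-cong (λ a b → ∧-comm (lx p a b) (ly q c d)) x) (applyLin-·ˡ (ly q c d) (lx p) x)

  yForm-entry : ∀ p i j → ComputesEntry p i j → yForm p ≗ inColumn (x i) j
  yForm-entry p i j (_ , _ , bl≡) (c , d) = begin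
    applyLin (λ a b → bl p a b c d) x
      ≡⟨ applyLin-cong (λ a b → trans (bl≡ a b c d) (rearrange ⌊ a ≟ i ⌋ ⌊ b ≟ c ⌋ ⌊ d ≟ j ⌋)) x ⟩
    applyLin (⌊ d ≟ j ⌋ ·ₘ δ i c) x
      ≡⟨ applyLin-·ˡ ⌊ d ≟ j ⌋ (δ i c) x ⟩
    ⌊ d ≟ j ⌋ ∧ applyLin (δ i c) x
      ≡⟨ cong (⌊ d ≟ j ⌋ ∧_) (applyLin-δ i c x) ⟩
    ⌊ d ≟ j ⌋ ∧ x i c
      ∎
    where
    rearrange : ∀ α β γ → α ∧ (β ∧ γ) ≡ γ ∧ (α ∧ β)
    rearrange α β γ = trans (sym (∧-assoc α β γ)) (∧-comm (α ∧ β) γ)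

  InSpan : ∀ {k} → Circuit n k → Poly n → Set
  InSpan C p = yForm p ∈Span lookup (activeForms C)

  sum-InSpan : ∀ {k} (C : Circuit n k) es →
               All (InSpan C) (values C) → InSpan C (gateVal (values C) (sum es))
  sum-InSpan C []             _   = ∈Span-resp-≗ (λ _ → applyLin-zeroˡ x) ∈Span-zero
  sum-InSpan C ((s , u) ∷ es) all =
    ∈Span-resp-≗ (yForm-addPoly (scalePoly s p) (gateVal (values C) (sum es)))
      (∈Span-xor (∈Span-resp-≗ (yForm-scalePoly s p) (∈Span-∧ s (lookup⁺ all u)))
                 (sum-InSpan C es all))
    where
    p = Vec.lookup (values C) u

  gate-InSpan : ∀ {k} (C : Circuit n k) g →
                All (InSpan C) (values C) → InSpan (C ▷ g) (gateVal (values C) g)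
  gate-InSpan C (inX _ _)  _   = ∈Span-resp-≗ (λ _ → applyLin-zeroˡ x) ∈Span-zero
  gate-InSpan C (inY _ _)  _   = ∈Span-resp-≗ (λ _ → applyLin-zeroˡ x) ∈Span-zero
  gate-InSpan C (sum es)   all = sum-InSpan C es all
  gate-InSpan C (prod u v) _   =
    ∈Span-resp-≗ (yForm-mulPoly (Vec.lookup (values C) u) (Vec.lookup (values C) v))
                 (head-∈Span-consIf (applyLin (xFactor C u) x) (yFactor C v) (activeForms C))

  InSpan-▷ : ∀ {k} (C : Circuit n k) g {p} → InSpan C p → InSpan (C ▷ g) p
  InSpan-▷ C (inX _ _)  = id
  InSpan-▷ C (inY _ _)  = id
  InSpan-▷ C (sum _)    = id
  InSpan-▷ C (prod u v) = ∈Span-consIf (applyLin (xFactor C u) x) (yFactor C v) (activeForms C)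

  values-InSpan : ∀ {k} (C : Circuit n k) → All (InSpan C) (values C)
  values-InSpan []      = []
  values-InSpan (C ▷ g) =
    ∷ʳ⁺ (All.map (λ {p} → InSpan-▷ C g {p}) (values-InSpan C)) (gate-InSpan C g (values-InSpan C))

  length-activeForms : ∀ {k} (C : Circuit n k) →
                       length (activeForms C) ≡ weight (map (λ μ → applyLin μ x) (muForms C))
  length-activeForms []             = refl
  length-activeForms (C ▷ inX _ _)  = length-activeForms C
  length-activeForms (C ▷ inY _ _)  = length-activeForms C
  length-activeForms (C ▷ sum _)    = length-activeForms C
  length-activeForms (C ▷ prod u v) = begin
    length (consIf (h μ) η (activeForms C))  ≡⟨ length-consIf (h μ) η _ _ (length-activeForms C) ⟩
    weight (h μ ∷ map h (muForms C))         ≡⟨ sym (weight-∷ʳ (map h (muForms C)) (h μ)) ⟩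
    weight (map h (muForms C) ++ [ h μ ])    ≡⟨ cong weight (sym (map-++ h (muForms C) [ μ ])) ⟩
    weight (map h (muForms C ++ [ μ ]))      ∎
    where
    h = λ μ → applyLin μ x
    μ = xFactor C u
    η = yFactor C v

rank-bound : ∀ {n r} (C : MatMulCircuit n) (x : Mat n) →
             HasIndependentRows x r → n * r ≤ weight (Γ C x)
rank-bound {n} {r} C x (f , rows-independent) =
  subst (n * r ≤_) (length-activeForms x (circuit C))
        (independent-∈Span⇒≤ (inColumns-independent {v = x ∘ f} rows-independent) column-∈Span)
  where
  column-∈Span : ∀ s → inColumns (x ∘ f) s ∈Span lookup (activeForms x (circuit C))
  column-∈Span s = ∈Span-resp-≗ (sym ∘ yForm-entry x _ (f t) j (computes C (f t) j))
                                (lookup⁺ (values-InSpan x (circuit C)) (output C (f t) j))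
    where
    j = proj₁ (remQuot {n} r s)
    t = proj₂ (remQuot {n} r s)

map-as-zipWith : ∀ {A B : Set} {f g h : A → B} (_∙_ : B → B → B) → (∀ a → f a ≡ g a ∙ h a) →
                 ∀ as → map f as ≡ zipWith _∙_ (map g as) (map h as)
map-as-zipWith _∙_ f≗g∙h []       = refl
map-as-zipWith _∙_ f≗g∙h (a ∷ as) = cong₂ _∷_ (f≗g∙h a) (map-as-zipWith _∙_ f≗g∙h as)

Γ-⊞ : ∀ {n} (C : MatMulCircuit n) x x' → Γ C (x ⊞ x') ≡ zipWith _xor_ (Γ C x) (Γ C x')
Γ-⊞ C x x' = map-as-zipWith _xor_ (λ μ → applyLin-⊞ʳ μ x x') (muForms (circuit C))

Γ-· : ∀ {n} (C : MatMulCircuit n) c x → Γ C (c ·ₘ x) ≡ map (c ∧_) (Γ C x)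
Γ-· C c x =
  trans (map-cong (λ μ → applyLin-·ʳ c μ x) (muForms (circuit C))) (map-∘ (muForms (circuit C)))

lemma7 : ∀ (n : ℕ) (C : MatMulCircuit n) →
             ((∀ (x x' : Mat n) → Γ C (x ⊞ x') ≡ zipWith _xor_ (Γ C x) (Γ C x'))
              × (∀ (c : Bool) (x : Mat n) → Γ C (c ·ₘ x) ≡ map (c ∧_) (Γ C x)))
             × (∀ (x : Mat n) (r : ℕ) → IsRank x r → n * r ≤ weight (Γ C x))
lemma7 n C = (Γ-⊞ C , Γ-· C) , λ x r x-has-rank-r → rank-bound C x (proj₁ x-has-rank-r)
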